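{- Let $\mathcal{R}$ be a collection of axis-parallel rectangles and let $\ell_0,\ell_1,\dots,\ell_k$ be horizontal lines with $y(\ell_0)<y(\ell_1)<\dots<y(\ell_k)$ such that every rectangle in $\mathcal{R}$ is intersected by either one or two of these lines. For $R\in\mathcal{R}$ let $T(R)=\max\{i:\ell_i\cap R\neq\emptyset\}$, and for $l\in\{0,1,2\}$ let $\mathcal{R}_l=\{R\in\mathcal{R}: T(R)\equiv l \pmod 3\}$. Suppose $R,R'\in\mathcal{R}_l$ for some $l\in\{0,1,2\}$. Then: (1) if $T(R)=T(R')$ and the projections of $R$ and $R'$ on the $x$-axis have non-empty intersection, then $R\cap R'\neq\emptyset$; (2) if $T(R)\neq T(R')$, then $R\cap R'=\emptyset$.
   Context: An axis-parallel rectangle is a closed set $\{(x,y): x^l\le x\le x^r,\ y^b\le y\le y^t\}$; a line intersects a rectangle if their intersection is non-empty; $y(\ell)$ denotes the $y$-coordinate of a horizontal line $\ell$. -}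

module Defs where

open import Level using (Level; _⊔_)
open import Data.Nat using (ℕ; suc)
open import Data.Fin using (Fin) renaming (_<_ to _<ᶠ_)
open import Data.Product using (_×_; _,_; ∃; ∃₂)
open import Data.Sum using (_⊎_)
open import Relation.Binary.Bundles using (TotalOrder)
open import Relation.Binary.PropositionalEquality using (_≡_)
open import Relation.Nullary using (¬_)

-- The plane is A × A for an arbitrary totally ordered set A
-- (the paper works with ℝ, which is an instance; the claim only uses the order).
module _ {c ℓ₁ ℓ₂} (O : TotalOrder c ℓ₁ ℓ₂) where
  open TotalOrder O renaming (Carrier to A)

  _<ₒ_ : A → A → Set (ℓ₁ ⊔ ℓ₂)
  x <ₒ y = x ≤ y × ¬ (x ≈ y)

  Point : Set c
  Point = A × A

  record Rect : Set c where
    constructor rect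
    field
      xl xr yb yt : A

  open Rect public

  _∈R_ : Point → Rect → Set ℓ₂
  (x , y) ∈R R = (xl R ≤ x × x ≤ xr R) × (yb R ≤ y × y ≤ yt R)

  -- the horizontal line with y-coordinate h, as a set of points
  _∈L_ : Point → A → Set ℓ₁
  (x , y) ∈L h = y ≈ h

  LineMeets : A → Rect → Set (c ⊔ ℓ₁ ⊔ ℓ₂)
  LineMeets h R = ∃ λ p → p ∈L h × p ∈R R

  RectsMeet : Rect → Rect → Set (c ⊔ ℓ₂)
  RectsMeet R R' = ∃ λ p → p ∈R R × p ∈R R'

  XProjMeet : Rect → Rect → Set (c ⊔ ℓ₂)
  XProjMeet R R' = ∃ λ x → (xl R ≤ x × x ≤ xr R) × (xl R' ≤ x × x ≤ xr R')

  module _ {k : ℕ} (ys : Fin (suc k) → A) where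
    StrictlyIncreasing : Set (ℓ₁ ⊔ ℓ₂)
    StrictlyIncreasing = ∀ i j → i <ᶠ j → ys i <ₒ ys j

    -- the set {i : ℓ_i ∩ R ≠ ∅} is {i, j} for some i, j, i.e. it has one or two elements
    OneOrTwoLines : Rect → Set (c ⊔ ℓ₁ ⊔ ℓ₂)
    OneOrTwoLines R = ∃₂ λ i j → ∀ m →
      (LineMeets (ys m) R → (m ≡ i ⊎ m ≡ j)) × ((m ≡ i ⊎ m ≡ j) → LineMeets (ys m) R)

    -- T(R) = t, i.e. t = max {i : ℓ_i ∩ R ≠ ∅}
    IsT : Rect → Fin (suc k) → Set (c ⊔ ℓ₁ ⊔ ℓ₂)
    IsT R t = LineMeets (ys t) R × (∀ j → t <ᶠ j → ¬ LineMeets (ys j) R)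

module Submission where

--   (1) if T(R) = T(R') the line ℓ_T crosses both rectangles, so any common
--       x-coordinate gives a common point on that line;
--   (2) if T(R) < T(R') then in fact T(R') ≥ T(R) + 3 (equal residues modulo
--       n are at least n apart).  A common point (x, y) lies below ℓ_{T(R)+1},
--       which R misses; R' contains (x, y) and meets ℓ_{T(R')}, hence meets
--       every line in between, in particular the three distinct lines
--       ℓ_{T(R)+1}, ℓ_{T(R)+2}, ℓ_{T(R')} — contradicting "one or two lines".

open import Defs
open import Data.Nat using (ℕ; suc; _%_)
open import Data.Fin using (Fin; toℕ)
open import Data.Product using (_×_)
open import Relation.Binary.Bundles using (TotalOrder)
open import Relation.Binary.PropositionalEquality using (_≡_)
open import Relation.Nullary using (¬_)

open import Data.Nat using (_+_; _*_; _/_; _≤_; _<_; NonZero)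
open import Data.Nat.Properties
  using (≤-refl; ≤-reflexive; ≤-trans; ≤-<-trans; +-mono-≤; *-monoˡ-≤; ≰⇒>; <⇒≱; <⇒≢;
         <⇒≤; <-trans; n≤1+n; <-cmp; +-commutativeSemigroup)
open import Data.Nat.DivMod using (m≡m%n+[m/n]*n)
open import Algebra.Properties.CommutativeSemigroup +-commutativeSemigroup using (x∙yz≈y∙xz)
open import Data.Fin using (fromℕ<)
open import Data.Fin.Properties using (toℕ<n; toℕ-fromℕ<; toℕ-injective)
open import Data.Product using (_,_; proj₁; proj₂)
open import Data.Sum using (_⊎_; inj₁; inj₂)
open import Data.Empty using (⊥; ⊥-elim)
open import Function using (_∘_)
open import Relation.Binary.Definitions using (tri<; tri≈; tri>)
open import Relation.Binary.PropositionalEquality using (refl; sym; trans; cong; subst; subst₂; _≢_)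

-- Two numbers with the same residue modulo n that differ at all differ by at
-- least n: writing a = r + q·n and b = r + q'·n, a < b forces q < q'.
sameResidue⇒far : ∀ n .{{_ : NonZero n}} {a b} → a < b → a % n ≡ b % n → n + a ≤ b
sameResidue⇒far n {a} {b} a<b same = begin
  n + a                         ≡⟨ cong (n +_) (m≡m%n+[m/n]*n a n) ⟩
  n + (a % n + a / n * n)       ≡⟨ x∙yz≈y∙xz n (a % n) (a / n * n) ⟩
  a % n + suc (a / n) * n       ≤⟨ +-mono-≤ (≤-reflexive same) (*-monoˡ-≤ n quotient<) ⟩
  b % n + b / n * n             ≡⟨ sym (m≡m%n+[m/n]*n b n) ⟩
  b                             ∎
  where
  open Data.Nat.Properties.≤-Reasoning
  -- if b's quotient were at most a's, then b ≤ a
  quotient< : a / n < b / n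
  quotient< = ≰⇒> λ b/n≤a/n → <⇒≱ a<b (begin
    b                     ≡⟨ m≡m%n+[m/n]*n b n ⟩
    b % n + b / n * n     ≤⟨ +-mono-≤ (≤-reflexive (sym same)) (*-monoˡ-≤ n b/n≤a/n) ⟩
    a % n + a / n * n     ≡⟨ sym (m≡m%n+[m/n]*n a n) ⟩
    a                     ∎)

noThreeDistinct : ∀ {a} {A : Set a} {i j g₀ g₁ g₂ : A} →
  (g₀ ≡ i ⊎ g₀ ≡ j) → (g₁ ≡ i ⊎ g₁ ≡ j) → (g₂ ≡ i ⊎ g₂ ≡ j) →
  g₀ ≢ g₁ → g₀ ≢ g₂ → g₁ ≢ g₂ → ⊥
noThreeDistinct (inj₁ g₀≡i) (inj₁ g₁≡i) _           g₀≢g₁ _     _     = g₀≢g₁ (trans g₀≡i (sym g₁≡i))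
noThreeDistinct (inj₂ g₀≡j) (inj₂ g₁≡j) _           g₀≢g₁ _     _     = g₀≢g₁ (trans g₀≡j (sym g₁≡j))
noThreeDistinct (inj₁ g₀≡i) (inj₂ _)    (inj₁ g₂≡i) _     g₀≢g₂ _     = g₀≢g₂ (trans g₀≡i (sym g₂≡i))
noThreeDistinct (inj₂ g₀≡j) (inj₁ _)    (inj₂ g₂≡j) _     g₀≢g₂ _     = g₀≢g₂ (trans g₀≡j (sym g₂≡j))
noThreeDistinct (inj₁ _)    (inj₂ g₁≡j) (inj₂ g₂≡j) _     _     g₁≢g₂ = g₁≢g₂ (trans g₁≡j (sym g₂≡j))
noThreeDistinct (inj₂ _)    (inj₁ g₁≡i) (inj₁ g₂≡i) _     _     g₁≢g₂ = g₁≢g₂ (trans g₁≡i (sym g₂≡i))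

module RectangleGeometry {c ℓ₁ ℓ₂} (O : TotalOrder c ℓ₁ ℓ₂) where
  open TotalOrder O using (module Eq; total; ≤-respʳ-≈; ≤-respˡ-≈)
    renaming (_≤_ to _⊑_; trans to ⊑-trans)

  meets⇒inYRange : ∀ {h R} → LineMeets O h R → yb R ⊑ h × h ⊑ yt R
  meets⇒inYRange ((_ , _) , py≈h , _ , yb⊑py , py⊑yt) =
    ≤-respʳ-≈ py≈h yb⊑py , ≤-respˡ-≈ py≈h py⊑yt

  inYRange⇒meets : ∀ {h x R} → xl R ⊑ x × x ⊑ xr R → yb R ⊑ h → h ⊑ yt R →
                   LineMeets O h R
  inYRange⇒meets {h} {x} x∈R yb⊑h h⊑yt = (x , h) , Eq.refl , x∈R , yb⊑h , h⊑yt

  meetsBetween : ∀ {R x y h h'} → _∈R_ O (x , y) R → LineMeets O h R →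
                 y ⊑ h' → h' ⊑ h → LineMeets O h' R
  meetsBetween (x∈R , yb⊑y , _) meetsH y⊑h' h'⊑h =
    inYRange⇒meets x∈R (⊑-trans yb⊑y y⊑h') (⊑-trans h'⊑h (proj₂ (meets⇒inYRange meetsH)))

  belowMissedLine : ∀ {R x y h h'} → _∈R_ O (x , y) R → LineMeets O h R →
                    h ⊑ h' → ¬ LineMeets O h' R → y ⊑ h'
  belowMissedLine {y = y} {h' = h'} (x∈R , _ , y⊑yt) meetsH h⊑h' missesH' with total y h'
  ... | inj₁ y⊑h' = y⊑h'
  ... | inj₂ h'⊑y = ⊥-elim (missesH'
          (inYRange⇒meets x∈R (⊑-trans (proj₁ (meets⇒inYRange meetsH)) h⊑h') (⊑-trans h'⊑y y⊑yt)))

  commonLine⇒meet : ∀ {h R R'} → LineMeets O h R → LineMeets O h R' →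
                    XProjMeet O R R' → RectsMeet O R R'
  commonLine⇒meet {h} meetsR meetsR' (x , x∈R , x∈R') =
    (x , h) , (x∈R , meets⇒inYRange meetsR) , (x∈R' , meets⇒inYRange meetsR')

  rectsMeet-sym : ∀ {R R'} → RectsMeet O R R' → RectsMeet O R' R
  rectsMeet-sym (p , p∈R , p∈R') = p , p∈R' , p∈R

module StackedLines {c ℓ₁ ℓ₂} (O : TotalOrder c ℓ₁ ℓ₂) {k : ℕ}
    (ys : Fin (suc k) → TotalOrder.Carrier O) (increasing : StrictlyIncreasing O ys) where
  open TotalOrder O using () renaming (_≤_ to _⊑_; trans to ⊑-trans; refl to ⊑-refl)
  open RectangleGeometry O

  ys-mono : ∀ {i j} → toℕ i ≤ toℕ j → ys i ⊑ ys j
  ys-mono {i} {j} i≤j with <-cmp (toℕ i) (toℕ j)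
  ... | tri< i<j _ _ = proj₁ (increasing i j i<j)
  ... | tri≈ _ i≡j _ = subst (λ j → ys i ⊑ ys j) (toℕ-injective i≡j) ⊑-refl
  ... | tri> _ _ j<i = ⊥-elim (<⇒≱ j<i i≤j)

  noThreeLines : ∀ {R} → OneOrTwoLines O ys R → ∀ {g₀ g₁ g₂} →
    toℕ g₀ < toℕ g₁ → toℕ g₁ < toℕ g₂ →
    LineMeets O (ys g₀) R → LineMeets O (ys g₁) R → LineMeets O (ys g₂) R → ⊥
  noThreeLines (i , j , lines) g₀<g₁ g₁<g₂ meets₀ meets₁ meets₂ =
    noThreeDistinct (proj₁ (lines _) meets₀) (proj₁ (lines _) meets₁) (proj₁ (lines _) meets₂)
      (distinct g₀<g₁) (distinct (<-trans g₀<g₁ g₁<g₂)) (distinct g₁<g₂)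
    where
    distinct : ∀ {g g'} → toℕ g < toℕ g' → g ≢ g'
    distinct g<g' refl = <⇒≢ g<g' refl

  -- The heart of part (2): if T(R') ≥ T(R) + 3, then R and R' are disjoint.
  -- A common point lies below ℓ_{T(R)+1}, so R' meets ℓ_{T(R)+1}, ℓ_{T(R)+2}
  -- and ℓ_{T(R')}.
  farApart⇒disjoint : ∀ {R R' t t'} → OneOrTwoLines O ys R' →
    IsT O ys R t → IsT O ys R' t' → 3 + toℕ t ≤ toℕ t' → ¬ RectsMeet O R R'
  farApart⇒disjoint {R' = R'} {t} {t'} twoLines (meetsT , missesAbove) (meetsT' , _) far
                    ((x , y) , p∈R , p∈R') =
    noThreeLines twoLines u<v v<t' (meetsR' u ≤-refl (<⇒≤ u<t')) (meetsR' v (<⇒≤ u<v) (<⇒≤ v<t'))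
      meetsT'
    where
    line : ∀ m → m ≤ toℕ t' → Fin (suc k)
    line m m≤t' = fromℕ< (≤-<-trans m≤t' (toℕ<n t'))

    toℕ-line : ∀ m m≤t' → toℕ (line m m≤t') ≡ m
    toℕ-line m m≤t' = toℕ-fromℕ< (≤-<-trans m≤t' (toℕ<n t'))

    2+t≤t' : 2 + toℕ t ≤ toℕ t'
    2+t≤t' = ≤-trans (n≤1+n _) far

    1+t≤t' : 1 + toℕ t ≤ toℕ t'
    1+t≤t' = ≤-trans (n≤1+n _) 2+t≤t'

    u v : Fin (suc k)
    u = line (1 + toℕ t) 1+t≤t'
    v = line (2 + toℕ t) 2+t≤t'

    t<u : toℕ t < toℕ u
    t<u = subst (toℕ t <_) (sym (toℕ-line _ 1+t≤t')) ≤-refl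

    u<v : toℕ u < toℕ v
    u<v = subst₂ _<_ (sym (toℕ-line _ 1+t≤t')) (sym (toℕ-line _ 2+t≤t')) ≤-refl

    v<t' : toℕ v < toℕ t'
    v<t' = subst (_< toℕ t') (sym (toℕ-line _ 2+t≤t')) far

    u<t' : toℕ u < toℕ t'
    u<t' = <-trans u<v v<t'

    -- R misses ℓ_{T(R)+1}, so the common point lies below it
    y⊑u : y ⊑ ys u
    y⊑u = belowMissedLine p∈R meetsT (ys-mono (<⇒≤ t<u)) (missesAbove u t<u)

    meetsR' : ∀ g → toℕ u ≤ toℕ g → toℕ g ≤ toℕ t' → LineMeets O (ys g) R'
    meetsR' g u≤g g≤t' = meetsBetween p∈R' meetsT' (⊑-trans y⊑u (ys-mono u≤g)) (ys-mono g≤t')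

mainTheorem6 : ∀ {c ℓ₁ ℓ₂ ℓ} (O : TotalOrder c ℓ₁ ℓ₂) (k : ℕ)
    (ys : Fin (suc k) → TotalOrder.Carrier O) → StrictlyIncreasing O ys →
    (𝓡 : Rect O → Set ℓ) → (∀ R → 𝓡 R → OneOrTwoLines O ys R) →
    ∀ R R' → 𝓡 R → 𝓡 R' →
    ∀ t t' → IsT O ys R t → IsT O ys R' t' →
    toℕ t % 3 ≡ toℕ t' % 3 →
    ((t ≡ t' → XProjMeet O R R' → RectsMeet O R R')
      × (¬ (t ≡ t') → ¬ RectsMeet O R R'))
mainTheorem6 O k ys increasing 𝓡 oneOrTwo R R' R∈𝓡 R'∈𝓡 t t' isT isT' sameResidue =
  sameTop , differentTop
  where
  open RectangleGeometry O
  open StackedLines O ys increasing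

  sameTop : t ≡ t' → XProjMeet O R R' → RectsMeet O R R'
  sameTop refl = commonLine⇒meet (proj₁ isT) (proj₁ isT')

  differentTop : ¬ (t ≡ t') → ¬ RectsMeet O R R'
  differentTop t≢t' with <-cmp (toℕ t) (toℕ t')
  ... | tri< t<t' _ _ =
    farApart⇒disjoint (oneOrTwo R' R'∈𝓡) isT isT' (sameResidue⇒far 3 t<t' sameResidue)
  ... | tri≈ _ t≡t' _ = ⊥-elim (t≢t' (toℕ-injective t≡t'))
  ... | tri> _ _ t'<t = farApart⇒disjoint (oneOrTwo R R∈𝓡) isT' isT
                          (sameResidue⇒far 3 t'<t (sym sameResidue)) ∘ rectsMeet-sym
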